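{- Let $m\ge 3$, $n\ge 5$, let $S$ be a self-identifying code of $K_m\times P_n$, and let $j\in[2,n-3]$. Then: (1) if $C_j\cap S=\emptyset$ and $j\in[3,n-4]$ (so $n\ge 7$), then $C_{j-1}\cup C_{j+1}\subseteq S$; (2) if $|C_j\cap S|=1$, then: for $j=2$, $|(C_1\cup C_3)\cap S|\ge m$; for $j=n-3$, $|(C_{n-4}\cup C_{n-2})\cap S|\ge m$; for $j\in[3,n-4]$, $|(C_{j-1}\cup C_{j+1})\cap S|\ge m+1$; (3) if $2\le |C_j\cap S|\le m-2$, then $|(C_{j-1}\cup C_{j+1})\cap S|\ge m$ and $(C_{j-1}\cup C_{j+1})\cap S\cap R_i\neq\emptyset$ for every row index $i\in[0,m-1]$; (4) if $|C_j\cap S|=m-1$, then $|(C_{j-1}\cup C_{j+1})\cap S|\ge m-1$; (5) if $|C_j\cap S|=m$ (i.e. $C_j\subseteq S$), then $|(C_{j-1}\cup C_{j+1})\cap S|\ge 3$.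
   Context: $[a,b]=\{a,a+1,\dots,b\}$. For a vertex $v$, $N[v]$ is its closed neighborhood. A nonempty set $S\subseteq V(G)$ is a self-identifying code of $G$ if for every vertex $v\in V(G)$: (1) $N[v]\cap S\neq\emptyset$, and (2) $\bigcap_{c\in N[v]\cap S}N[c]=\{v\}$. With $V(K_m)=\{v_0,\dots,v_{m-1}\}$ and $V(P_n)=\{0,\dots,n-1\}$ (consecutively numbered path), $K_m\times P_n$ has vertices $(v_i,j)$, with $(v_i,j)$ adjacent to $(v_{i'},j')$ iff $i\neq i'$ and $|j-j'|=1$. The $i$-th row is $R_i=\{(v_i,j):0\le j\le n-1\}$ and the $j$-th column is $C_j=\{(v_i,j):0\le i\le m-1\}$. -}

module Defs where

open import Data.Nat using (ℕ; suc; _∸_; _≡ᵇ_)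
open import Data.Fin using (Fin; toℕ)
open import Data.Bool using (Bool; true; false; if_then_else_; _∧_; _∨_)
open import Data.List using (List; map; allFin; cartesianProduct)
open import Data.Nat.ListAction using (sum)
open import Data.Product using (_×_; _,_; proj₁; proj₂; ∃-syntax)
open import Data.Sum using (_⊎_)
open import Relation.Binary.PropositionalEquality using (_≡_)
open import Relation.Nullary using (¬_)
open import Function.Bundles using (_⇔_)

Vtx : ℕ → ℕ → Set
Vtx m n = Fin m × Fin n

VSet : ℕ → ℕ → Set
VSet m n = Vtx m n → Bool

Adj : ∀ {m n} → Vtx m n → Vtx m n → Set
Adj (i , j) (i' , j') =
  ¬ (i ≡ i') × (suc (toℕ j) ≡ toℕ j' ⊎ suc (toℕ j') ≡ toℕ j)

InClosedNbhd : ∀ {m n} → Vtx m n → Vtx m n → Set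
InClosedNbhd v w = w ≡ v ⊎ Adj v w

-- Self-identifying code: S nonempty, and for every v,
--  (1) N[v] ∩ S ≠ ∅,  (2) ⋂_{c ∈ N[v] ∩ S} N[c] = {v}.
IsSelfIdCode : ∀ {m n} → VSet m n → Set
IsSelfIdCode {m} {n} S =
  (∃[ v ] S v ≡ true) ×
  ((v : Vtx m n) →
     (∃[ c ] (InClosedNbhd v c × S c ≡ true)) ×
     ((w : Vtx m n) →
        ((∀ (c : Vtx m n) → InClosedNbhd v c → S c ≡ true → InClosedNbhd c w)
          ⇔ (w ≡ v))))

card : ∀ {m n} → VSet m n → ℕ
card {m} {n} A =
  sum (map (λ v → if A v then 1 else 0) (cartesianProduct (allFin m) (allFin n)))

inColᵇ : ∀ {m n} → ℕ → Vtx m n → Bool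
inColᵇ j v = toℕ (proj₂ v) ≡ᵇ j

colInter : ∀ {m n} → ℕ → VSet m n → VSet m n
colInter j S v = inColᵇ j v ∧ S v

nbColsInter : ∀ {m n} → ℕ → VSet m n → VSet m n
nbColsInter j S v = (inColᵇ (j ∸ 1) v ∨ inColᵇ (suc j) v) ∧ S v

module Submission where

-- All bounds come from one consequence of self-identification: for v ≢ w there is a codeword
-- c ∈ N[v] with w ∉ N[c]. In K_m × P_n, separating
--   a non-codeword (c , j) from (i , j) gives a codeword neighbour in row i, so C_{j-1} ∪ C_{j+1}
--   meets every row i for which column j has a non-codeword outside row i;
--   (a , j-1) from (a , j-3), or (a , j+1) from (a , j+3), shows that (a , j±1) is a codeword
--   unless column j has a codeword outside row a;
--   a vertex from a neighbour, and then from the codeword found, gives every vertex two codeword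
--   neighbours; doing this at (a , j) and at (row x , j) produces three codewords beside column j.
-- The counting side: a duplicate-free list of members bounds card from below, and a list with one
-- member in each row (but possibly one) gives the bounds m, m ∸ 1 and, with a second member in
-- one row, m + 1.

open import Defs
open import Data.Nat using (ℕ; zero; suc; _∸_; _+_; _≤_; _<_; z≤n; s≤s)
open import Data.Nat.Properties
  using (≤-refl; ≤-reflexive; +-mono-≤; +-suc; <⇒≱; ≡⇒≡ᵇ; suc-injective; ≤-<-trans; m∸n≤m; m+[n∸m]≡n;
        <⇒≤; <⇒≢; +-comm; ∸-monoʳ-<; m+n≤o⇒n≤o; m+n≤o⇒m≤o∸n; m≤o∸n⇒m+n≤o; module ≤-Reasoning)
  renaming (_≟_ to _≟ℕ_)
open import Data.Nat.ListAction using (sum)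
open import Data.Fin using (Fin; toℕ; fromℕ<; punchIn) renaming (zero to fzero; suc to fsuc)
import Data.Fin.Properties as Fin
open import Data.Bool using (Bool; true; false; if_then_else_; _∧_; _∨_; not)
open import Data.Bool.Properties using (T-≡; ¬-not; ∨-zeroʳ) renaming (_≟_ to _≟ᵇ_)
open import Data.List using (List; []; _∷_; length; map; tabulate; allFin; cartesianProduct)
open import Data.List.Properties using (length-tabulate)
open import Data.List.Membership.Propositional using (_∈_)
open import Data.List.Membership.Propositional.Properties using (∈-allFin; ∈-cartesianProduct⁺)
open import Data.List.Relation.Binary.Subset.Propositional using (_⊆_)
open import Data.List.Relation.Unary.Any using (here; there)
open import Data.List.Relation.Unary.All using (All; []; _∷_)
import Data.List.Relation.Unary.All as All
import Data.List.Relation.Unary.All.Properties as All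
open import Data.List.Relation.Unary.AllPairs using ([]; _∷_)
open import Data.List.Relation.Unary.Unique.Propositional using (Unique)
import Data.List.Relation.Unary.Unique.Propositional.Properties as Unique
open import Data.Product using (_×_; _,_; proj₁; proj₂; ∃; ∃-syntax; ∃₂)
open import Data.Product.Properties using (≡-dec)
open import Data.Sum using (_⊎_; inj₁; inj₂)
open import Function using (_∘_)
open import Function.Bundles using (Equivalence)
open import Relation.Binary.Definitions using (DecidableEquality)
open import Relation.Binary.PropositionalEquality
  using (_≡_; _≢_; refl; sym; trans; cong; cong₂; subst; ≢-sym)
open import Relation.Nullary using (¬_; Dec; yes; no; contradiction)
open import Relation.Nullary.Decidable using (⌊_⌋; _×-dec_; _⊎-dec_; ¬?; map′; decidable-stable)
open import Relation.Unary using (Decidable)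

open Equivalence using (to)

module Counting {A : Set} (_≟_ : DecidableEquality A) where

  indicator : (A → Bool) → A → ℕ
  indicator P x = if P x then 1 else 0

  count : (A → Bool) → List A → ℕ
  count P xs = sum (map (indicator P) xs)

  _∖_ : (A → Bool) → A → (A → Bool)
  (P ∖ x) y = P y ∧ not ⌊ y ≟ x ⌋

  ∖-intro : ∀ {P x y} → P y ≡ true → x ≢ y → (P ∖ x) y ≡ true
  ∖-intro {x = x} {y} Py x≢y with y ≟ x
  ... | yes y≡x = contradiction (sym y≡x) x≢y
  ... | no _ = cong (_∧ true) Py

  ∖-sub : ∀ {P} x y → (P ∖ x) y ≡ true → P y ≡ true
  ∖-sub {P} x y h with P y
  ... | true = refl

  indicator-∖-self : ∀ {P} x → indicator (P ∖ x) x ≡ 0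
  indicator-∖-self {P} x with x ≟ x
  ... | no x≢x = contradiction refl x≢x
  ... | yes _ with P x
  ...   | true = refl
  ...   | false = refl

  indicator-mono : ∀ {P Q} x → (P x ≡ true → Q x ≡ true) → indicator P x ≤ indicator Q x
  indicator-mono {P} {Q} x P⇒Q with P x | Q x
  ... | false | _ = z≤n
  ... | true | true = ≤-refl
  ... | true | false = contradiction (P⇒Q refl) λ ()

  count-mono : ∀ {P Q} xs → (∀ x → P x ≡ true → Q x ≡ true) → count P xs ≤ count Q xs
  count-mono [] P⊆Q = z≤n
  count-mono {P} {Q} (x ∷ xs) P⊆Q = +-mono-≤ (indicator-mono {P} {Q} x (P⊆Q x)) (count-mono {P} {Q} xs P⊆Q)

  count-remove : ∀ {P x xs} → x ∈ xs → P x ≡ true → suc (count (P ∖ x) xs) ≤ count P xs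
  count-remove {P} {x} {_ ∷ xs} (here refl) Px
    rewrite indicator-∖-self {P} x | Px = s≤s (count-mono {P ∖ x} {P} xs (∖-sub {P} x))
  count-remove {P} {x} {y ∷ xs} (there x∈xs) Px = begin
    suc (indicator (P ∖ x) y + count (P ∖ x) xs) ≡⟨ +-suc _ _ ⟨
    indicator (P ∖ x) y + suc (count (P ∖ x) xs) ≤⟨ +-mono-≤ (indicator-mono {P ∖ x} {P} y (∖-sub {P} x y))
                                                              (count-remove {P} x∈xs Px) ⟩
    indicator P y + count P xs                   ∎
    where open ≤-Reasoning

  length≤count : ∀ {P xs ys} → Unique xs → All (λ x → P x ≡ true) xs → xs ⊆ ys → length xs ≤ count P ys
  length≤count [] [] _ = z≤n
  length≤count {P} {x ∷ xs} {ys} (x∉xs ∷ unique) (Px ∷ Pxs) xs⊆ys = begin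
    suc (length xs)         ≤⟨ s≤s (length≤count {P ∖ x} unique P∖x-xs (xs⊆ys ∘ there)) ⟩
    suc (count (P ∖ x) ys)  ≤⟨ count-remove {P} (xs⊆ys (here refl)) Px ⟩
    count P ys              ∎
    where
    open ≤-Reasoning
    P∖x-xs : All (λ y → (P ∖ x) y ≡ true) xs
    P∖x-xs = All.zipWith (λ (Py , x≢y) → ∖-intro {P} Py x≢y) (Pxs , x∉xs)

  count≢0⇒member : ∀ {P} xs → count P xs ≢ 0 → ∃[ x ] P x ≡ true
  count≢0⇒member [] count≢0 = contradiction refl count≢0
  count≢0⇒member {P} (x ∷ xs) count≢0 with P x in Px
  ... | true = x , Px
  ... | false = count≢0⇒member xs count≢0

row : ∀ {m n} → Vtx m n → Fin m
row = proj₁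

col : ∀ {m n} → Vtx m n → ℕ
col v = toℕ (proj₂ v)

col-≢ : ∀ {m n} {v w : Vtx m n} → col w ≢ col v → w ≢ v
col-≢ cw≢cv refl = cw≢cv refl

2+n≢n : ∀ k → 2 + k ≢ k
2+n≢n zero ()
2+n≢n (suc k) 2+k≡k = 2+n≢n k (suc-injective 2+k≡k)

at : ∀ {m n} → Fin m → (k : ℕ) → k < n → Vtx m n
at i k k<n = i , fromℕ< k<n

col-at : ∀ {m n} (i : Fin m) {k} (k<n : k < n) → col (at i k k<n) ≡ k
col-at i k<n = Fin.toℕ-fromℕ< k<n

two-columns-back : ∀ {m n} (v : Vtx m n) → 2 ≤ col v → ∃[ w ] (row w ≡ row v × 2 + col w ≡ col v)
two-columns-back (i , k) 2≤k =
  at i (toℕ k ∸ 2) k-2<n , refl , trans (cong (2 +_) (col-at i k-2<n)) (m+[n∸m]≡n 2≤k)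
  where k-2<n = ≤-<-trans (m∸n≤m (toℕ k) 2) (Fin.toℕ<n k)

two-columns-ahead : ∀ {m n} (v : Vtx m n) → 2 + col v < n → ∃[ w ] (row w ≡ row v × 2 + col v ≡ col w)
two-columns-ahead (i , k) 2+k<n = at i (2 + toℕ k) 2+k<n , refl , sym (col-at i 2+k<n)

another-row : ∀ {m} → 2 ≤ m → (i : Fin m) → ∃[ i′ ] i′ ≢ i
another-row (s≤s (s≤s _)) fzero = fsuc fzero , λ ()
another-row (s≤s (s≤s _)) (fsuc _) = fzero , λ ()

MeetsRow : ∀ {m n} → VSet m n → Fin m → Set
MeetsRow A i = ∃[ v ] (A v ≡ true × row v ≡ i)

module _ {m n : ℕ} where

  _≟ᵥ_ : DecidableEquality (Vtx m n)
  _≟ᵥ_ = ≡-dec Fin._≟_ Fin._≟_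

  open Counting _≟ᵥ_

  ∈-allVertices : (v : Vtx m n) → v ∈ cartesianProduct (allFin m) (allFin n)
  ∈-allVertices (i , k) = ∈-cartesianProduct⁺ (∈-allFin i) (∈-allFin k)

  card≢0⇒nonempty : (A : VSet m n) → card A ≢ 0 → ∃[ v ] A v ≡ true
  card≢0⇒nonempty A = count≢0⇒member (cartesianProduct (allFin m) (allFin n))

  length≤card : ∀ {A : VSet m n} {vs} → Unique vs → All (λ v → A v ≡ true) vs → length vs ≤ card A
  length≤card {A} unique Avs = length≤count {A} unique Avs (λ {v} _ → ∈-allVertices v)

  card≡1⇒singleton : (A : VSet m n) → card A ≡ 1 → ∃[ v ] (A v ≡ true × ∀ w → A w ≡ true → w ≡ v)
  card≡1⇒singleton A card≡1
    with card≢0⇒nonempty A (λ card≡0 → contradiction (trans (sym card≡1) card≡0) λ ())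
  ... | v , Av = v , Av , only-v
    where
    only-v : ∀ w → A w ≡ true → w ≡ v
    only-v w Aw with w ≟ᵥ v
    ... | yes w≡v = w≡v
    ... | no w≢v = contradiction (length≤card ((w≢v ∷ []) ∷ [] ∷ []) (Aw ∷ Av ∷ []))
                                 (<⇒≱ (≤-reflexive (cong suc card≡1)))

  3≤card : ∀ {A : VSet m n} {x y z} → x ≢ y → x ≢ z → y ≢ z →
           A x ≡ true → A y ≡ true → A z ≡ true → 3 ≤ card A
  3≤card x≢y x≢z y≢z Ax Ay Az = length≤card ((x≢y ∷ x≢z ∷ []) ∷ (y≢z ∷ []) ∷ [] ∷ []) (Ax ∷ Ay ∷ Az ∷ [])

module RowTransversal {m n} {A : VSet (suc m) n} (a : Fin (suc m))
                      (meets : ∀ i → i ≢ a → MeetsRow A i) where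

  met : ∀ i → MeetsRow A (punchIn a i)
  met i = meets (punchIn a i) (Fin.punchInᵢ≢i a i)

  pick : Fin m → Vtx (suc m) n
  pick i = proj₁ (met i)

  row-pick : ∀ i → row (pick i) ≡ punchIn a i
  row-pick i = proj₂ (proj₂ (met i))

  transversal : List (Vtx (suc m) n)
  transversal = tabulate pick

  length-transversal : length transversal ≡ m
  length-transversal = length-tabulate pick

  unique : Unique transversal
  unique = Unique.tabulate⁺ λ {i} {j} pickᵢ≡pickⱼ →
    Fin.punchIn-injective a i j (trans (sym (row-pick i)) (trans (cong row pickᵢ≡pickⱼ) (row-pick j)))

  all-in-A : All (λ v → A v ≡ true) transversal
  all-in-A = All.tabulate⁺ λ i → proj₁ (proj₂ (met i))

  avoids : ∀ {x} → row x ≡ a → All (x ≢_) transversal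
  avoids rx≡a = All.tabulate⁺ λ i x≡pickᵢ →
    Fin.punchInᵢ≢i a i (trans (sym (row-pick i)) (trans (cong row (sym x≡pickᵢ)) rx≡a))

card-≥-rows-but : ∀ {m n} {A : VSet m n} (a : Fin m) → (∀ i → i ≢ a → MeetsRow A i) → m ∸ 1 ≤ card A
card-≥-rows-but {suc m} {A = A} a meets = begin
  m                  ≡⟨ length-transversal ⟨
  length transversal ≤⟨ length≤card unique all-in-A ⟩
  card A             ∎
  where open RowTransversal a meets
        open ≤-Reasoning

card-≥-rows : ∀ {m n} {A : VSet m n} → (∀ i → MeetsRow A i) → m ≤ card A
card-≥-rows {zero} meets = z≤n
card-≥-rows {suc m} {A = A} meets with meets fzero
... | x , Ax , rx≡0 = begin
  suc m                  ≡⟨ cong suc length-transversal ⟨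
  length (x ∷ transversal) ≤⟨ length≤card (avoids rx≡0 ∷ unique) (Ax ∷ all-in-A) ⟩
  card A                 ∎
  where open RowTransversal fzero (λ i _ → meets i)
        open ≤-Reasoning

card-≥-rows-with-pair : ∀ {m n} {A : VSet m n} (a : Fin m) {x y} → row x ≡ a → row y ≡ a → x ≢ y →
  A x ≡ true → A y ≡ true → (∀ i → i ≢ a → MeetsRow A i) → suc m ≤ card A
card-≥-rows-with-pair {suc m} {A = A} a {x} {y} rx≡a ry≡a x≢y Ax Ay meets = begin
  suc (suc m)                  ≡⟨ cong (suc ∘ suc) length-transversal ⟨
  length (x ∷ y ∷ transversal) ≤⟨ length≤card ((x≢y ∷ avoids rx≡a) ∷ avoids ry≡a ∷ unique)
                                              (Ax ∷ Ay ∷ all-in-A) ⟩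
  card A                       ∎
  where open RowTransversal a meets
        open ≤-Reasoning

non-member-outside-row : ∀ {m n} {A : VSet m n} → card A < m ∸ 1 →
  (k : Fin n) (i : Fin m) → ∃[ c ] (c ≢ i × A (c , k) ≡ false)
non-member-outside-row {A = A} small k i with Fin.any? (λ c → ¬? (c Fin.≟ i) ×-dec (A (c , k) ≟ᵇ false))
... | yes found = found
... | no none = contradiction (card-≥-rows-but i member) (<⇒≱ small)
  where
  member : ∀ c → c ≢ i → MeetsRow A c
  member c c≢i = (c , k) , ¬-not (λ Ack≡false → none (c , c≢i , Ack≡false)) , refl

non-member-in-column : ∀ {m n} {A : VSet m n} → card A < m → (k : Fin n) → ∃[ c ] A (c , k) ≡ false
non-member-in-column {A = A} small k with Fin.any? (λ c → A (c , k) ≟ᵇ false)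
... | yes found = found
... | no none = contradiction (card-≥-rows member) (<⇒≱ small)
  where
  member : ∀ c → MeetsRow A c
  member c = (c , k) , ¬-not (λ Ack≡false → none (c , Ack≡false)) , refl

inColᵇ-intro : ∀ {m n} {v : Vtx m n} {j} → col v ≡ j → inColᵇ j v ≡ true
inColᵇ-intro {v = v} {j} cv≡j = to T-≡ (≡⇒≡ᵇ (col v) j cv≡j)

colInter-on-column : ∀ {m n} {S : VSet m n} {v j} → col v ≡ j → colInter j S v ≡ S v
colInter-on-column {S = S} {v} cv≡j = cong (_∧ S v) (inColᵇ-intro {v = v} cv≡j)

nbColsInter-intro : ∀ {m n} {S : VSet m n} {v} j → col v ≡ j ∸ 1 ⊎ col v ≡ suc j → S v ≡ true →
  nbColsInter j S v ≡ true
nbColsInter-intro {v = v} j (inj₁ cv≡j-1) Sv =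
  cong₂ (λ b s → (b ∨ inColᵇ (suc j) v) ∧ s) (inColᵇ-intro {v = v} cv≡j-1) Sv
nbColsInter-intro {v = v} j (inj₂ cv≡j+1) Sv =
  trans (cong₂ (λ b s → (inColᵇ (j ∸ 1) v ∨ b) ∧ s) (inColᵇ-intro {v = v} cv≡j+1) Sv)
        (cong (_∧ true) (∨-zeroʳ _))

adjacent-column : ∀ {m n} {u v : Vtx m n} {j} → Adj u v → col u ≡ j → col v ≡ j ∸ 1 ⊎ col v ≡ suc j
adjacent-column (_ , inj₁ cu+1≡cv) refl = inj₂ (sym cu+1≡cv)
adjacent-column (_ , inj₂ cv+1≡cu) refl = inj₁ (cong (_∸ 1) cv+1≡cu)

adjacent-to-row⇒≢ : ∀ {m n} {x z : Vtx m n} {k} → Adj (row x , k) z → x ≢ z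
adjacent-to-row⇒≢ x∼z x≡z = proj₁ x∼z (cong row x≡z)

module _ {m n : ℕ} where

  adjacent? : (v w : Vtx m n) → Dec (Adj v w)
  adjacent? (i , k) (i′ , k′) = ¬? (i Fin.≟ i′) ×-dec (suc (toℕ k) ≟ℕ toℕ k′ ⊎-dec suc (toℕ k′) ≟ℕ toℕ k)

  closedNbhd? : (v w : Vtx m n) → Dec (InClosedNbhd v w)
  closedNbhd? v w = (w ≟ᵥ v) ⊎-dec adjacent? v w

  ∃-vertex? : {P : Vtx m n → Set} → Decidable P → Dec (∃ P)
  ∃-vertex? P? = map′ (λ (i , k , p) → (i , k) , p) (λ ((i , k) , p) → i , k , p)
                      (Fin.any? λ i → Fin.any? λ k → P? (i , k))

module SelfIdentifyingCode {m n} {S : VSet m n} (code : IsSelfIdCode S) where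

  separator : ∀ v w → w ≢ v → ∃[ c ] (InClosedNbhd v c × S c ≡ true × ¬ InClosedNbhd c w)
  separator v w w≢v with ∃-vertex? (λ c → closedNbhd? v c ×-dec (S c ≟ᵇ true) ×-dec ¬? (closedNbhd? c w))
  ... | yes found = found
  ... | no none = contradiction (to (proj₂ (proj₂ code v) w) dominated) w≢v
    where
    dominated : ∀ c → InClosedNbhd v c → S c ≡ true → InClosedNbhd c w
    dominated c v∼c Sc = decidable-stable (closedNbhd? c w) λ c≁w → none (c , v∼c , Sc , c≁w)

  codeword-or-codeword-ahead : ∀ v → 2 ≤ col v →
    S v ≡ true ⊎ ∃[ c ] (row c ≢ row v × col c ≡ suc (col v) × S c ≡ true)
  codeword-or-codeword-ahead v 2≤cv
    with w , rw≡rv , 2+cw≡cv ← two-columns-back v 2≤cv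
    with separator v w (col-≢ (2+n≢n (col w) ∘ trans 2+cw≡cv ∘ sym))
  ... | c , inj₁ refl , Sc , _ = inj₁ Sc
  ... | c , inj₂ (rv≢rc , inj₁ cv+1≡cc) , Sc , _ = inj₂ (c , ≢-sym rv≢rc , sym cv+1≡cc , Sc)
  ... | c , inj₂ (rv≢rc , inj₂ cc+1≡cv) , Sc , c≁w =
    contradiction (inj₂ ((λ rc≡rw → rv≢rc (trans (sym rw≡rv) (sym rc≡rw))) ,
                         inj₂ (suc-injective (trans 2+cw≡cv (sym cc+1≡cv))))) c≁w

  codeword-or-codeword-behind : ∀ v → 2 + col v < n →
    S v ≡ true ⊎ ∃[ c ] (row c ≢ row v × suc (col c) ≡ col v × S c ≡ true)
  codeword-or-codeword-behind v 2+cv<n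
    with w , rw≡rv , 2+cv≡cw ← two-columns-ahead v 2+cv<n
    with separator v w (col-≢ (2+n≢n (col v) ∘ trans 2+cv≡cw))
  ... | c , inj₁ refl , Sc , _ = inj₁ Sc
  ... | c , inj₂ (rv≢rc , inj₂ cc+1≡cv) , Sc , _ = inj₂ (c , ≢-sym rv≢rc , cc+1≡cv , Sc)
  ... | c , inj₂ (rv≢rc , inj₁ cv+1≡cc) , Sc , c≁w =
    contradiction (inj₂ ((λ rc≡rw → rv≢rc (trans (sym rw≡rv) (sym rc≡rw))) ,
                         inj₁ (trans (cong suc (sym cv+1≡cc)) 2+cv≡cw))) c≁w

  codeword-neighbour-in-row : ∀ v i → i ≢ row v → S v ≡ false → ∃[ x ] (row x ≡ i × Adj v x × S x ≡ true)
  codeword-neighbour-in-row v@(r , k) i i≢r Sv≡false with separator v (i , k) (i≢r ∘ cong row)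
  ... | c , inj₁ refl , Sc , _ = contradiction (trans (sym Sv≡false) Sc) λ ()
  ... | c , inj₂ v∼c@(_ , columns) , Sc , c≁w with row c Fin.≟ i
  ...   | yes rc≡i = c , rc≡i , v∼c , Sc
  ...   | no rc≢i = contradiction (inj₂ (rc≢i , swap columns)) c≁w
    where
    swap : suc (toℕ k) ≡ col c ⊎ suc (col c) ≡ toℕ k → suc (col c) ≡ toℕ k ⊎ suc (toℕ k) ≡ col c
    swap (inj₁ e) = inj₂ e
    swap (inj₂ e) = inj₁ e

  another-codeword-neighbour : ∀ v w → Adj v w → ∃[ c ] (Adj v c × S c ≡ true × c ≢ w)
  another-codeword-neighbour v w v∼w with separator v w (proj₁ v∼w ∘ sym ∘ cong row)
  ... | c , inj₁ refl , Sc , c≁w = contradiction (inj₂ v∼w) c≁w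
  ... | c , inj₂ v∼c , Sc , c≁w = c , v∼c , Sc , c≁w ∘ inj₁ ∘ sym

  two-codeword-neighbours : ∀ v w → Adj v w →
    ∃₂ λ x y → x ≢ y × Adj v x × Adj v y × S x ≡ true × S y ≡ true
  two-codeword-neighbours v w v∼w with another-codeword-neighbour v w v∼w
  ... | x , v∼x , Sx , _ with another-codeword-neighbour v x v∼x
  ...   | y , v∼y , Sy , y≢x = x , y , ≢-sym y≢x , v∼x , v∼y , Sx , Sy

  ColumnCodewordsIn : ℕ → Fin m → Set
  ColumnCodewordsIn j a = ∀ c → col c ≡ j → S c ≡ true → row c ≡ a

  codeword-beside-sparse-column : ∀ {j} → 3 ≤ j → 4 + j ≤ n →
    ∀ v → col v ≡ j ∸ 1 ⊎ col v ≡ suc j → ColumnCodewordsIn j (row v) → S v ≡ true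
  codeword-beside-sparse-column {j} 3≤j _ v (inj₁ cv≡j-1) sparse
    with codeword-or-codeword-ahead v (subst (2 ≤_) (sym cv≡j-1) (m+n≤o⇒m≤o∸n 2 3≤j))
  ... | inj₁ Sv = Sv
  ... | inj₂ (c , rc≢rv , cc≡cv+1 , Sc) =
    contradiction (sparse c (trans cc≡cv+1 (trans (cong suc cv≡j-1) (m+[n∸m]≡n (m+n≤o⇒n≤o 2 3≤j)))) Sc)
                  rc≢rv
  codeword-beside-sparse-column {j} _ 4+j≤n v (inj₂ cv≡j+1) sparse
    with codeword-or-codeword-behind v (subst (λ c → 2 + c < n) (sym cv≡j+1) 4+j≤n)
  ... | inj₁ Sv = Sv
  ... | inj₂ (c , rc≢rv , cc+1≡cv , Sc) =
    contradiction (sparse c (suc-injective (trans cc+1≡cv cv≡j+1)) Sc) rc≢rv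

  module Column (j : ℕ) (j<n : j < n) where

    k : Fin n
    k = fromℕ< j<n

    col-k : toℕ k ≡ j
    col-k = Fin.toℕ-fromℕ< j<n

    S≡colInter : ∀ c → S (c , k) ≡ colInter j S (c , k)
    S≡colInter c = sym (colInter-on-column {S = S} {c , k} col-k)

    nbColsInter∋neighbour : ∀ {a x} → Adj (a , k) x → S x ≡ true → nbColsInter j S x ≡ true
    nbColsInter∋neighbour {x = x} ak∼x = nbColsInter-intro {S = S} {x} j (adjacent-column ak∼x col-k)

    nbCols-meets-row : ∀ {c} i → i ≢ c → S (c , k) ≡ false → MeetsRow (nbColsInter j S) i
    nbCols-meets-row {c} i i≢c Sck≡false with codeword-neighbour-in-row (c , k) i i≢c Sck≡false
    ... | x , rx≡i , ck∼x , Sx = x , nbColsInter∋neighbour ck∼x Sx , rx≡i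

    nbCols-meets-every-row : card (colInter j S) < m ∸ 1 → ∀ i → MeetsRow (nbColsInter j S) i
    nbCols-meets-every-row small i with non-member-outside-row small k i
    ... | c , c≢i , Cck≡false = nbCols-meets-row i (≢-sym c≢i) (trans (S≡colInter c) Cck≡false)

    m≤card-nbCols : card (colInter j S) < m ∸ 1 → m ≤ card (nbColsInter j S)
    m≤card-nbCols small = card-≥-rows (nbCols-meets-every-row small)

    m∸1≤card-nbCols : card (colInter j S) < m → m ∸ 1 ≤ card (nbColsInter j S)
    m∸1≤card-nbCols small with non-member-in-column small k
    ... | a , Cak≡false =
      card-≥-rows-but a λ i i≢a → nbCols-meets-row i i≢a (trans (S≡colInter a) Cak≡false)

    1+m≤card-nbCols : card (colInter j S) ≡ 1 → card (colInter j S) < m ∸ 1 → 3 ≤ j → 4 + j ≤ n →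
      suc m ≤ card (nbColsInter j S)
    1+m≤card-nbCols card≡1 small 3≤j 4+j≤n with card≡1⇒singleton (colInter j S) card≡1
    ... | v , _ , only-v =
      card-≥-rows-with-pair (row v) {left} {right} refl refl (col-≢ j-1≢j+1)
        (nbColsInter∋beside _ (inj₁ col-left)) (nbColsInter∋beside _ (inj₂ col-right))
        (λ i _ → nbCols-meets-every-row small i)
      where
      sparse : ColumnCodewordsIn j (row v)
      sparse c cc≡j Sc = cong row (only-v c (trans (colInter-on-column {S = S} {c} cc≡j) Sc))
      j-1<n : j ∸ 1 < n
      j-1<n = ≤-<-trans (m∸n≤m j 1) j<n
      j+1<n : suc j < n
      j+1<n = m+n≤o⇒n≤o 2 4+j≤n
      left right : Vtx m n
      left = at (row v) (j ∸ 1) j-1<n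
      right = at (row v) (suc j) j+1<n
      col-left : col left ≡ j ∸ 1
      col-left = col-at (row v) j-1<n
      col-right : col right ≡ suc j
      col-right = col-at (row v) j+1<n
      j-1≢j+1 : col left ≢ col right
      j-1≢j+1 cl≡cr = <⇒≢ (s≤s (m∸n≤m j 1)) (trans (sym col-left) (trans cl≡cr col-right))
      nbColsInter∋beside : ∀ k′ → let x = (row v , k′) in
        col x ≡ j ∸ 1 ⊎ col x ≡ suc j → nbColsInter j S x ≡ true
      nbColsInter∋beside k′ beside =
        nbColsInter-intro {S = S} {row v , k′} j beside
          (codeword-beside-sparse-column 3≤j 4+j≤n (row v , k′) beside sparse)

    two-codewords-beside : 2 ≤ m → suc j < n → ∀ a →
      ∃₂ λ x y → x ≢ y × Adj (a , k) x × Adj (a , k) y × S x ≡ true × S y ≡ true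
    two-codewords-beside 2≤m j+1<n a with another-row 2≤m a
    ... | a′ , a′≢a = two-codeword-neighbours (a , k) (at a′ (suc j) j+1<n)
                        (≢-sym a′≢a , inj₁ (trans (cong suc col-k) (sym (col-at a′ j+1<n))))

    3≤card-nbCols : 2 ≤ m → suc j < n → 3 ≤ card (nbColsInter j S)
    -- Matching on 2 ≤ m instead of building a row with fromℕ< would let card unfold in the goal.
    3≤card-nbCols 2≤m j+1<n with two-codewords-beside 2≤m j+1<n (fromℕ< (<⇒≤ 2≤m))
    ... | x , y , x≢y , _∼x , _∼y , Sx , Sy with two-codewords-beside 2≤m j+1<n (row x)
    ...   | z₁ , z₂ , z₁≢z₂ , x∼z₁ , x∼z₂ , Sz₁ , Sz₂ with z₁ ≟ᵥ y
    ...     | no z₁≢y = 3≤card x≢y (adjacent-to-row⇒≢ x∼z₁) (≢-sym z₁≢y)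
                          (nbColsInter∋neighbour _∼x Sx) (nbColsInter∋neighbour _∼y Sy)
                          (nbColsInter∋neighbour x∼z₁ Sz₁)
    ...     | yes refl = 3≤card x≢y (adjacent-to-row⇒≢ x∼z₂) z₁≢z₂
                          (nbColsInter∋neighbour _∼x Sx) (nbColsInter∋neighbour _∼y Sy)
                          (nbColsInter∋neighbour x∼z₂ Sz₂)

corollary11 : (m n : ℕ) → 3 ≤ m → 5 ≤ n → (S : VSet m n) → IsSelfIdCode S →
    (j : ℕ) → 2 ≤ j → j ≤ n ∸ 3 →
    -- (1)
    (((v : Vtx m n) → toℕ (proj₂ v) ≡ j → S v ≡ false) → 3 ≤ j → j ≤ n ∸ 4 →
       (v : Vtx m n) → (toℕ (proj₂ v) ≡ j ∸ 1 ⊎ toℕ (proj₂ v) ≡ suc j) → S v ≡ true)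
    -- (2)
    × (card (colInter j S) ≡ 1 →
         (j ≡ 2 → m ≤ card (nbColsInter j S))
         × (j ≡ n ∸ 3 → m ≤ card (nbColsInter j S))
         × (3 ≤ j → j ≤ n ∸ 4 → suc m ≤ card (nbColsInter j S)))
    -- (3)
    × (2 ≤ card (colInter j S) → card (colInter j S) ≤ m ∸ 2 →
         (m ≤ card (nbColsInter j S))
         × ((i : Fin m) → ∃[ v ] (nbColsInter j S v ≡ true × proj₁ v ≡ i)))
    -- (4)
    × (card (colInter j S) ≡ m ∸ 1 → m ∸ 1 ≤ card (nbColsInter j S))
    -- (5)
    × (card (colInter j S) ≡ m → 3 ≤ card (nbColsInter j S))
corollary11 m n 3≤m 5≤n S code j _ j≤n∸3 =
    (λ empty 3≤j j≤n∸4 v cv → codeword-beside-sparse-column 3≤j (4+j≤n j≤n∸4) v cv (empty⇒sparse empty))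
  , (λ card≡1 → (λ _ → m≤card-nbCols (singleton-small card≡1))
              , (λ _ → m≤card-nbCols (singleton-small card≡1))
              , λ 3≤j j≤n∸4 → 1+m≤card-nbCols card≡1 (singleton-small card≡1) 3≤j (4+j≤n j≤n∸4))
  , (λ _ card≤m-2 → let small = ≤-<-trans card≤m-2 (∸-monoʳ-< (s≤s (s≤s z≤n)) 2≤m)
                    in m≤card-nbCols small , nbCols-meets-every-row small)
  , (λ card≡m-1 → m∸1≤card-nbCols (subst (_< m) (sym card≡m-1) (∸-monoʳ-< (s≤s z≤n) (<⇒≤ 2≤m))))
  , (λ _ → 3≤card-nbCols 2≤m j+1<n)
  where
  open SelfIdentifyingCode code
  2≤m : 2 ≤ m
  2≤m = <⇒≤ 3≤m
  3+j≤n : 3 + j ≤ n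
  3+j≤n = subst (_≤ n) (+-comm j 3) (m≤o∸n⇒m+n≤o j (m+n≤o⇒n≤o 2 5≤n) j≤n∸3)
  j+1<n : suc j < n
  j+1<n = <⇒≤ 3+j≤n
  open Column j (<⇒≤ j+1<n)
  4+j≤n : j ≤ n ∸ 4 → 4 + j ≤ n
  4+j≤n j≤n∸4 = subst (_≤ n) (+-comm j 4) (m≤o∸n⇒m+n≤o j (m+n≤o⇒n≤o 1 5≤n) j≤n∸4)
  singleton-small : card (colInter j S) ≡ 1 → card (colInter j S) < m ∸ 1
  singleton-small card≡1 = subst (_< m ∸ 1) (sym card≡1) (m+n≤o⇒m≤o∸n 2 3≤m)
  empty⇒sparse : (∀ v → col v ≡ j → S v ≡ false) → ∀ {a} → ColumnCodewordsIn j a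
  empty⇒sparse empty c cc≡j Sc = contradiction (trans (sym Sc) (empty c cc≡j)) λ ()
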